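{- Let $m,n,s,w$ be positive integers (with $m\geq 2$ for the first statement). (i) If $z$ is an integer with $z(m-1,n;s)<z\leq w-\lfloor w/m\rfloor$, then $z(m,n;s)<w$. (ii) If non-negative integers $a_1,\dots,a_m$ with $a_1+\cdots+a_m=w$ satisfy $|a_i-a_j|\leq 1$ for all $1\leq i<j\leq m$ and ${a_1\choose s}+\cdots+{a_m\choose s}>(s-1){n\choose s}$, then $z(m,n;s)<w$.
   Context: The Zarankiewicz number $z(m,n;s)$ is the maximum number of edges of a bipartite graph with left part of size $m$ and right part of size $n$ containing no $K_{s,s}$, i.e., with no $s$ left vertices and $s$ right vertices all pairwise adjacent across the parts. -}

module Defs where

open import Data.Nat using (ℕ; zero; suc; _+_; _≤_)
open import Data.Bool using (Bool; true; false; T)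
open import Data.Fin using (Fin)
open import Data.Fin.Subset using (Subset; _∈_; ∣_∣)
open import Data.Product using (Σ; _×_)
open import Relation.Binary.PropositionalEquality using (_≡_)
open import Relation.Nullary using (¬_)

∑ : (n : ℕ) → (Fin n → ℕ) → ℕ
∑ zero    f = 0
∑ (suc n) f = f Fin.zero + ∑ n (λ i → f (Fin.suc i))

BipGraph : ℕ → ℕ → Set
BipGraph m n = Fin m → Fin n → Bool

toℕ𝔹 : Bool → ℕ
toℕ𝔹 true  = 1
toℕ𝔹 false = 0

edges : {m n : ℕ} → BipGraph m n → ℕ
edges {m} {n} G = ∑ m (λ i → ∑ n (λ j → toℕ𝔹 (G i j)))

ContainsKss : {m n : ℕ} → ℕ → BipGraph m n → Set
ContainsKss {m} {n} s G =
  Σ (Subset m) λ S → Σ (Subset n) λ U →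
    (∣ S ∣ ≡ s) × (∣ U ∣ ≡ s) × (∀ i j → i ∈ S → j ∈ U → T (G i j))

Kss-free : {m n : ℕ} → ℕ → BipGraph m n → Set
Kss-free s G = ¬ ContainsKss s G

IsZarankiewicz : ℕ → ℕ → ℕ → ℕ → Set
IsZarankiewicz m n s z =
  (Σ (BipGraph m n) λ G → Kss-free s G × edges G ≡ z)
  × (∀ (G : BipGraph m n) → Kss-free s G → edges G ≤ z)

-- Take a K_{s,s}-free graph G with z(m,n;s) edges and suppose e(G) ≥ w.
-- (i) A row of minimum degree has at most ⌊e(G)/m⌋ edges; deleting it leaves
-- a K_{s,s}-free graph on m − 1 rows with at least w − ⌊w/m⌋ > z(m−1,n;s)
-- edges. (ii) Double counting s-sets of common neighbours gives the
-- Kővári–Sós–Turán bound ∑ᵢ C(deg i, s) ≤ (s − 1) C(n, s); since x ↦ C(x, s)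
-- is convex and lies above its chord over [q, q + 1] with q = min aᵢ, the
-- balanced aᵢ with ∑ aᵢ ≤ ∑ deg i have ∑ᵢ C(aᵢ, s) ≤ ∑ᵢ C(deg i, s).
module Submission where

open import Defs
open import Data.Nat using (ℕ; zero; suc; _+_; _∸_; _*_; _<_; _≤_; _≤′_; ≤′-refl; ≤′-step; z≤n; s≤s; _≤?_; ∣_-_∣)
open import Data.Nat.Properties
open import Data.Nat.DivMod using (_/_; _%_; m≡m%n+[m/n]*n; m%n<n)
open import Data.Nat.Combinatorics using (_C_; nCk+nC[k+1]≡[n+1]C[k+1])
open import Data.Nat.Solver using (module +-*-Solver)
open +-*-Solver using (solve; _:=_; _:+_)
open import Data.Bool using (Bool; true; false; _∧_; T)
open import Data.Bool.Properties using (∧-assoc; ∧-identityʳ)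
open import Data.Fin using (Fin; zero; suc; punchIn) renaming (_<_ to _<ᶠ_)
open import Data.Fin.Properties using () renaming (<-cmp to <ᶠ-cmp)
open import Data.Fin.Subset using (Subset; _∈_; ∣_∣; ⊥; outside)
open import Data.Fin.Subset.Properties using (∉⊥; ∣⊥∣≡0)
open import Data.Vec using ([]; _∷_; here; there; insertAt)
open import Data.Product using (Σ; ∃; _×_; _,_; proj₁; proj₂)
open import Data.Sum using (inj₁; inj₂)
open import Data.Empty using (⊥-elim)
open import Relation.Nullary using (yes; no)
open import Relation.Binary using (tri<; tri≈; tri>)
open import Relation.Binary.PropositionalEquality using (_≡_; refl; sym; trans; cong; cong₂; subst; subst₂; module ≡-Reasoning)

∑-cong : ∀ n {f g : Fin n → ℕ} → (∀ i → f i ≡ g i) → ∑ n f ≡ ∑ n g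
∑-cong zero    f≗g = refl
∑-cong (suc n) f≗g = cong₂ _+_ (f≗g zero) (∑-cong n (λ i → f≗g (suc i)))

∑-mono-≤ : ∀ n {f g : Fin n → ℕ} → (∀ i → f i ≤ g i) → ∑ n f ≤ ∑ n g
∑-mono-≤ zero    f≤g = z≤n
∑-mono-≤ (suc n) f≤g = +-mono-≤ (f≤g zero) (∑-mono-≤ n (λ i → f≤g (suc i)))

∑-distrib-+ : ∀ n (f g : Fin n → ℕ) → ∑ n (λ i → f i + g i) ≡ ∑ n f + ∑ n g
∑-distrib-+ zero    f g = refl
∑-distrib-+ (suc n) f g = trans
  (cong (f zero + g zero +_) (∑-distrib-+ n (λ i → f (suc i)) (λ i → g (suc i))))
  (solve 4 (λ a b c d → (a :+ b) :+ (c :+ d) := (a :+ c) :+ (b :+ d)) refl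
     (f zero) (g zero) (∑ n (λ i → f (suc i))) (∑ n (λ i → g (suc i))))

∑-distribʳ-* : ∀ n (f : Fin n → ℕ) c → ∑ n (λ i → f i * c) ≡ ∑ n f * c
∑-distribʳ-* zero    f c = refl
∑-distribʳ-* (suc n) f c =
  trans (cong (f zero * c +_) (∑-distribʳ-* n (λ i → f (suc i)) c))
        (sym (*-distribʳ-+ c (f zero) _))

∑-replicate : ∀ n c → ∑ n (λ _ → c) ≡ n * c
∑-replicate zero    c = refl
∑-replicate (suc n) c = cong (c +_) (∑-replicate n c)

∑-remove : ∀ m (f : Fin (suc m) → ℕ) i → ∑ (suc m) f ≡ f i + ∑ m (λ k → f (punchIn i k))
∑-remove m       f zero    = refl
∑-remove (suc m) f (suc i) =
  trans (cong (f zero +_) (∑-remove m (λ k → f (suc k)) i))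
        (solve 3 (λ a b c → a :+ (b :+ c) := b :+ (a :+ c)) refl
           (f zero) (f (suc i)) (∑ m (λ k → f (suc (punchIn i k)))))

argmin : ∀ m (f : Fin (suc m) → ℕ) → ∃ λ k → ∀ i → f k ≤ f i
argmin zero    f = zero , λ { zero → ≤-refl }
argmin (suc m) f with argmin m (λ i → f (suc i))
... | k , min with f zero ≤? f (suc k)
...   | yes f₀≤ = zero  , λ { zero → ≤-refl ; (suc i) → ≤-trans f₀≤ (min i) }
...   | no  f₀≰ = suc k , λ { zero → <⇒≤ (≰⇒> f₀≰) ; (suc i) → min i }

*-min≤∑ : ∀ m (f : Fin (suc m) → ℕ) k → (∀ i → f k ≤ f i) → suc m * f k ≤ ∑ (suc m) f
*-min≤∑ m f k min = subst (_≤ ∑ (suc m) f) (∑-replicate (suc m) (f k)) (∑-mono-≤ (suc m) min)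

degree : ∀ {m n} → BipGraph m n → Fin m → ℕ
degree {n = n} G i = ∑ n (λ j → toℕ𝔹 (G i j))

removeRow : ∀ {m n} → BipGraph (suc m) n → Fin (suc m) → BipGraph m n
removeRow G i k = G (punchIn i k)

edges-removeRow : ∀ {m n} (G : BipGraph (suc m) n) i → edges G ≡ degree G i + edges (removeRow G i)
edges-removeRow {m} G i = ∑-remove m (degree G) i

∣insertAt-outside∣ : ∀ {m} (S : Subset m) i → ∣ insertAt S i outside ∣ ≡ ∣ S ∣
∣insertAt-outside∣ S            zero    = refl
∣insertAt-outside∣ (true  ∷ S) (suc i) = cong suc (∣insertAt-outside∣ S i)
∣insertAt-outside∣ (false ∷ S) (suc i) = ∣insertAt-outside∣ S i

∈-insertAt-outside : ∀ {m} (S : Subset m) i j → j ∈ insertAt S i outside →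
                     ∃ λ k → k ∈ S × punchIn i k ≡ j
∈-insertAt-outside S       zero    (suc j) (there j∈) = j , j∈ , refl
∈-insertAt-outside (b ∷ S) (suc i) zero    here       = zero , here , refl
∈-insertAt-outside (b ∷ S) (suc i) (suc j) (there j∈) with ∈-insertAt-outside S i j j∈
... | k , k∈S , refl = suc k , there k∈S , refl

removeRow-Kss-free : ∀ {m n} s (G : BipGraph (suc m) n) i → Kss-free s G → Kss-free s (removeRow G i)
removeRow-Kss-free s G i free (S , U , ∣S∣≡s , ∣U∣≡s , complete) =
  free (insertAt S i outside , U , trans (∣insertAt-outside∣ S i) ∣S∣≡s , ∣U∣≡s , complete′)
  where
  complete′ : ∀ j l → j ∈ insertAt S i outside → l ∈ U → T (G j l)
  complete′ j l j∈ l∈U with ∈-insertAt-outside S i j j∈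
  ... | k , k∈S , refl = complete k l k∈S l∈U

-- The case d > ⌊w/k⌋ uses w < (⌊w/k⌋ + 1) k.
∸-share≤rest : ∀ k′ {w d D} → suc k′ * d ≤ d + D → w ≤ d + D → w ∸ w / suc k′ ≤ D
∸-share≤rest k′ {w} {d} {D} share w≤ = m≤n+o⇒m∸n≤o w q (subst (w ≤_) (+-comm D q) w≤D+q)
  where
  q : ℕ
  q = w / suc k′
  k′d≤D : k′ * d ≤ D
  k′d≤D = +-cancelˡ-≤ d (k′ * d) D share
  w<[1+q]k : w < suc q + k′ * suc q
  w<[1+q]k = begin-strict
      w                         ≡⟨ m≡m%n+[m/n]*n w (suc k′) ⟩
      w % suc k′ + q * suc k′  <⟨ +-monoˡ-< (q * suc k′) (m%n<n w (suc k′)) ⟩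
      suc k′ + q * suc k′      ≡⟨ *-comm (suc q) (suc k′) ⟩
      suc q + k′ * suc q       ∎
    where open ≤-Reasoning
  w≤D+q : w ≤ D + q
  w≤D+q with d ≤? q
  ... | yes d≤q = ≤-trans w≤ (≤-trans (+-monoˡ-≤ D d≤q) (≤-reflexive (+-comm q D)))
  ... | no  d≰q = ≤-pred (begin-strict
      w                   <⟨ w<[1+q]k ⟩
      suc q + k′ * suc q  ≤⟨ +-monoʳ-≤ (suc q) (≤-trans (*-monoʳ-≤ k′ (≰⇒> d≰q)) k′d≤D) ⟩
      suc q + D           ≡⟨ +-comm (suc q) D ⟩
      D + suc q           ≡⟨ +-suc D q ⟩
      suc (D + q)         ∎)
    where open ≤-Reasoning

zarankiewicz-step : ∀ m′ n s w zprev → IsZarankiewicz m′ n s zprev → zprev < w ∸ w / suc m′ →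
                    ∀ zmn → IsZarankiewicz (suc m′) n s zmn → zmn < w
zarankiewicz-step m′ n s w zprev (_ , zprev-bound) zprev< zmn ((G , free , eG≡zmn) , _)
  with w ≤? zmn
... | no  w≰zmn = ≰⇒> w≰zmn
... | yes w≤zmn = ⊥-elim (<⇒≱ zprev< (begin
      w ∸ w / suc m′          ≤⟨ ∸-share≤rest m′ share (subst (w ≤_) (trans (sym eG≡zmn) split) w≤zmn) ⟩
      edges (removeRow G i)  ≤⟨ zprev-bound (removeRow G i) (removeRow-Kss-free s G i free) ⟩
      zprev                  ∎))
  where
  open ≤-Reasoning
  i : Fin (suc m′)
  i = proj₁ (argmin m′ (degree G))
  split : edges G ≡ degree G i + edges (removeRow G i)
  split = edges-removeRow G i
  share : suc m′ * degree G i ≤ degree G i + edges (removeRow G i)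
  share = subst (suc m′ * degree G i ≤_) split (*-min≤∑ m′ (degree G) i (proj₂ (argmin m′ (degree G))))

-- Kővári–Sós–Turán counting

_⊆ᵇ_ : ∀ {n} → Subset n → (Fin n → Bool) → Bool
[]          ⊆ᵇ f = true
(false ∷ U) ⊆ᵇ f = U ⊆ᵇ (λ j → f (suc j))
(true  ∷ U) ⊆ᵇ f = f zero ∧ U ⊆ᵇ (λ j → f (suc j))

⊥⊆ᵇ : ∀ n (f : Fin n → Bool) → (⊥ {n = n}) ⊆ᵇ f ≡ true
⊥⊆ᵇ zero    f = refl
⊥⊆ᵇ (suc n) f = ⊥⊆ᵇ n (λ j → f (suc j))

⊆ᵇ-sound : ∀ {n} (U : Subset n) f → T (U ⊆ᵇ f) → ∀ j → j ∈ U → T (f j)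
⊆ᵇ-sound (false ∷ U) f U⊆f (suc j) (there j∈U) = ⊆ᵇ-sound U (λ j → f (suc j)) U⊆f j j∈U
⊆ᵇ-sound (true  ∷ U) f U⊆f j j∈ with f zero in f₀≡
⊆ᵇ-sound (true  ∷ U) f U⊆f zero    here       | true = subst T (sym f₀≡) _
⊆ᵇ-sound (true  ∷ U) f U⊆f (suc j) (there j∈U) | true = ⊆ᵇ-sound U (λ j → f (suc j)) U⊆f j j∈U

subset-of-size : ∀ m (p : Fin m → Bool) k → k ≤ ∑ m (λ i → toℕ𝔹 (p i)) →
                 Σ (Subset m) λ S → ∣ S ∣ ≡ k × (∀ i → i ∈ S → T (p i))
subset-of-size zero    p zero k≤ = [] , refl , λ i ()
subset-of-size (suc m) p k    k≤ with p zero in p₀≡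
subset-of-size (suc m) p zero    k≤        | true = ⊥ , ∣⊥∣≡0 (suc m) , λ i i∈⊥ → ⊥-elim (∉⊥ i∈⊥)
subset-of-size (suc m) p (suc k) (s≤s k≤) | true with subset-of-size m (λ i → p (suc i)) k k≤
... | S , ∣S∣≡k , S⊆p = true ∷ S , cong suc ∣S∣≡k , ∈⇒p
  where
  ∈⇒p : ∀ i → i ∈ (true ∷ S) → T (p i)
  ∈⇒p zero    here       = subst T (sym p₀≡) _
  ∈⇒p (suc i) (there i∈S) = S⊆p i i∈S
subset-of-size (suc m) p k k≤ | false with subset-of-size m (λ i → p (suc i)) k k≤
... | S , ∣S∣≡k , S⊆p = false ∷ S , ∣S∣≡k , ∈⇒p
  where
  ∈⇒p : ∀ i → i ∈ (false ∷ S) → T (p i)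
  ∈⇒p (suc i) (there i∈S) = S⊆p i i∈S

weighted-pascal : ∀ (w b : Bool) d s →
  toℕ𝔹 w * ((toℕ𝔹 b + d) C suc s) ≡ toℕ𝔹 w * (d C suc s) + toℕ𝔹 (w ∧ b) * (d C s)
weighted-pascal false b     d s = refl
weighted-pascal true  false d s = sym (+-identityʳ _)
weighted-pascal true  true  d s = begin
  1 * (suc d C suc s)           ≡⟨ *-identityˡ _ ⟩
  suc d C suc s                 ≡⟨ sym (nCk+nC[k+1]≡[n+1]C[k+1] d s) ⟩
  d C s + d C suc s             ≡⟨ +-comm (d C s) (d C suc s) ⟩
  d C suc s + d C s             ≡⟨ sym (cong₂ _+_ (*-identityˡ (d C suc s)) (*-identityˡ (d C s))) ⟩
  1 * (d C suc s) + 1 * (d C s) ∎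
  where open ≡-Reasoning

-- Double counting of pairs (i, U) with U an s-set of neighbours of row i;
-- the row weights w are needed for the induction on n: s-sets containing
-- column 0 are counted among the rows adjacent to it.
∑-degree-choose≤ : ∀ n s m (G : BipGraph m n) (w : Fin m → Bool) t →
  (∀ (U : Subset n) → ∣ U ∣ ≡ s → ∑ m (λ i → toℕ𝔹 (w i ∧ U ⊆ᵇ G i)) ≤ t) →
  ∑ m (λ i → toℕ𝔹 (w i) * (degree G i C s)) ≤ t * (n C s)
∑-degree-choose≤ n zero m G w t codegree≤ = begin
    ∑ m (λ i → toℕ𝔹 (w i) * 1)           ≡⟨ ∑-cong m (λ i → trans (*-identityʳ _) (cong toℕ𝔹 (sym w∧⊥⊆≡w))) ⟩
    ∑ m (λ i → toℕ𝔹 (w i ∧ ⊥ ⊆ᵇ G i))  ≤⟨ codegree≤ ⊥ (∣⊥∣≡0 n) ⟩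
    t                                   ≡⟨ sym (*-identityʳ t) ⟩
    t * 1                               ∎
  where
  open ≤-Reasoning
  w∧⊥⊆≡w : ∀ {i} → w i ∧ ⊥ ⊆ᵇ G i ≡ w i
  w∧⊥⊆≡w {i} = trans (cong (w i ∧_) (⊥⊆ᵇ n (G i))) (∧-identityʳ (w i))
∑-degree-choose≤ zero (suc s) m G w t codegree≤ =
  subst (_≤ t * 0) (sym (trans (∑-cong m (λ i → *-zeroʳ (toℕ𝔹 (w i))))
                               (trans (∑-replicate m 0) (*-zeroʳ m)))) z≤n
∑-degree-choose≤ (suc n) (suc s) m G w t codegree≤ = begin
    ∑ m (λ i → toℕ𝔹 (w i) * (degree G i C suc s))
  ≡⟨ ∑-cong m (λ i → weighted-pascal (w i) (G i zero) (degree G′ i) s) ⟩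
    ∑ m (λ i → toℕ𝔹 (w i) * (degree G′ i C suc s) + toℕ𝔹 (w i ∧ G i zero) * (degree G′ i C s))
  ≡⟨ ∑-distrib-+ m _ _ ⟩
    ∑ m (λ i → toℕ𝔹 (w i) * (degree G′ i C suc s)) + ∑ m (λ i → toℕ𝔹 (w i ∧ G i zero) * (degree G′ i C s))
  ≤⟨ +-mono-≤ (∑-degree-choose≤ n (suc s) m G′ w t (λ U → codegree≤ (false ∷ U)))
              (∑-degree-choose≤ n s m G′ (λ i → w i ∧ G i zero) t codegree₀≤) ⟩
    t * (n C suc s) + t * (n C s)
  ≡⟨ sym (*-distribˡ-+ t _ _) ⟩
    t * (n C suc s + n C s)
  ≡⟨ cong (t *_) (trans (+-comm (n C suc s) (n C s)) (nCk+nC[k+1]≡[n+1]C[k+1] n s)) ⟩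
    t * (suc n C suc s)
  ∎
  where
  open ≤-Reasoning
  G′ : BipGraph m n
  G′ i j = G i (suc j)
  codegree₀≤ : ∀ (U : Subset n) → ∣ U ∣ ≡ s → ∑ m (λ i → toℕ𝔹 ((w i ∧ G i zero) ∧ U ⊆ᵇ G′ i)) ≤ t
  codegree₀≤ U ∣U∣≡s = subst (_≤ t) (∑-cong m (λ i → cong toℕ𝔹 (sym (∧-assoc (w i) (G i zero) _))))
                                     (codegree≤ (true ∷ U) (cong suc ∣U∣≡s))

Kss-free⇒∑-degree-choose≤ : ∀ m n s (G : BipGraph m n) → Kss-free (suc s) G →
                             ∑ m (λ i → degree G i C suc s) ≤ s * (n C suc s)
Kss-free⇒∑-degree-choose≤ m n s G free =
  subst (_≤ s * (n C suc s)) (∑-cong m (λ i → *-identityˡ _))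
        (∑-degree-choose≤ n (suc s) m G (λ _ → true) s codegree≤)
  where
  codegree≤ : ∀ (U : Subset n) → ∣ U ∣ ≡ suc s → ∑ m (λ i → toℕ𝔹 (U ⊆ᵇ G i)) ≤ s
  codegree≤ U ∣U∣≡ with suc s ≤? ∑ m (λ i → toℕ𝔹 (U ⊆ᵇ G i))
  ... | no  s≰ = ≤-pred (≰⇒> s≰)
  ... | yes s< with subset-of-size m (λ i → U ⊆ᵇ G i) (suc s) s<
  ...   | S , ∣S∣≡ , S⊆ = ⊥-elim (free (S , U , ∣S∣≡ , ∣U∣≡ ,
                                         λ i j i∈S j∈U → ⊆ᵇ-sound U (G i) (S⊆ i i∈S) j j∈U))

-- Convexity of binomial coefficients

C-suc-mono : ∀ x k → x C k ≤ suc x C k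
C-suc-mono x zero    = ≤-refl
C-suc-mono x (suc k) = subst (x C suc k ≤_) (nCk+nC[k+1]≡[n+1]C[k+1] x k) (m≤n+m _ _)

C-monoˡ-≤ : ∀ k {x y} → x ≤ y → x C k ≤ y C k
C-monoˡ-≤ k x≤y = go (≤⇒≤′ x≤y)
  where
  go : ∀ {x y} → x ≤′ y → x C k ≤ y C k
  go ≤′-refl        = ≤-refl
  go (≤′-step x≤′y) = ≤-trans (go x≤′y) (C-suc-mono _ k)

-- By Pascal's rule the increments of C(·, s + 1) are the nondecreasing C(·, s).
C-increment-lower : ∀ s p d → p C suc s + d * (p C s) ≤ (p + d) C suc s
C-increment-lower s p zero = subst (λ y → p C suc s + 0 ≤ y C suc s) (sym (+-identityʳ p))
                                   (≤-reflexive (+-identityʳ _))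
C-increment-lower s p (suc d) = begin
    p C suc s + (p C s + d * (p C s))
  ≡⟨ solve 3 (λ a b c → a :+ (b :+ c) := b :+ (a :+ c)) refl (p C suc s) (p C s) (d * (p C s)) ⟩
    p C s + (p C suc s + d * (p C s))
  ≤⟨ +-mono-≤ (C-monoˡ-≤ s (m≤m+n p d)) (C-increment-lower s p d) ⟩
    (p + d) C s + (p + d) C suc s
  ≡⟨ nCk+nC[k+1]≡[n+1]C[k+1] (p + d) s ⟩
    suc (p + d) C suc s
  ≡⟨ cong (_C suc s) (sym (+-suc p d)) ⟩
    (p + suc d) C suc s
  ∎
  where open ≤-Reasoning

C-increment-upper : ∀ s p d → (p + d) C suc s ≤ p C suc s + d * ((p + d) C s)
C-increment-upper s p zero = subst (λ y → y C suc s ≤ p C suc s + 0) (sym (+-identityʳ p))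
                                   (≤-reflexive (sym (+-identityʳ _)))
C-increment-upper s p (suc d) = begin
    (p + suc d) C suc s
  ≡⟨ cong (_C suc s) (+-suc p d) ⟩
    suc (p + d) C suc s
  ≡⟨ sym (nCk+nC[k+1]≡[n+1]C[k+1] (p + d) s) ⟩
    (p + d) C s + (p + d) C suc s
  ≤⟨ +-monoʳ-≤ ((p + d) C s) (C-increment-upper s p d) ⟩
    (p + d) C s + (p C suc s + d * ((p + d) C s))
  ≤⟨ +-mono-≤ top (+-monoʳ-≤ (p C suc s) (*-monoʳ-≤ d top)) ⟩
    c + (p C suc s + d * c)
  ≡⟨ solve 3 (λ a b e → a :+ (b :+ e) := b :+ (a :+ e)) refl c (p C suc s) (d * c) ⟩
    p C suc s + (c + d * c)
  ∎
  where
  open ≤-Reasoning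
  c : ℕ
  c = (p + suc d) C s
  top : (p + d) C s ≤ c
  top = C-monoˡ-≤ s (+-monoʳ-≤ p (n≤1+n d))

-- The chord of C(·, s + 1) over [q, q + 1] has slope C(q, s); both sides are
-- moved so that no subtraction occurs.
C-above-chord : ∀ s q x → q C suc s + x * (q C s) ≤ x C suc s + q * (q C s)
C-above-chord s q x with ≤-total q x
... | inj₁ q≤x = subst (λ y → q C suc s + y * (q C s) ≤ y C suc s + q * (q C s))
                       (m+[n∸m]≡n q≤x) (right (x ∸ q))
  where
  right : ∀ d → q C suc s + (q + d) * (q C s) ≤ (q + d) C suc s + q * (q C s)
  right d = begin
      q C suc s + (q + d) * c
    ≡⟨ cong (q C suc s +_) (*-distribʳ-+ c q d) ⟩
      q C suc s + (q * c + d * c)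
    ≡⟨ solve 3 (λ a b e → a :+ (b :+ e) := (a :+ e) :+ b) refl (q C suc s) (q * c) (d * c) ⟩
      (q C suc s + d * c) + q * c
    ≤⟨ +-monoˡ-≤ (q * c) (C-increment-lower s q d) ⟩
      (q + d) C suc s + q * c
    ∎
    where
    open ≤-Reasoning
    c : ℕ
    c = q C s
... | inj₂ x≤q = subst (λ y → y C suc s + x * (y C s) ≤ x C suc s + y * (y C s))
                       (m+[n∸m]≡n x≤q) (left (q ∸ x))
  where
  left : ∀ d → (x + d) C suc s + x * ((x + d) C s) ≤ x C suc s + (x + d) * ((x + d) C s)
  left d = begin
      (x + d) C suc s + x * c
    ≤⟨ +-monoˡ-≤ (x * c) (C-increment-upper s x d) ⟩
      (x C suc s + d * c) + x * c
    ≡⟨ solve 3 (λ a b e → (a :+ b) :+ e := a :+ (e :+ b)) refl (x C suc s) (d * c) (x * c) ⟩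
      x C suc s + (x * c + d * c)
    ≡⟨ cong (x C suc s +_) (sym (*-distribʳ-+ c x d)) ⟩
      x C suc s + (x + d) * c
    ∎
    where
    open ≤-Reasoning
    c : ℕ
    c = (x + d) C s

C-on-chord : ∀ s q a → q ≤ a → a ≤ suc q → a C suc s + q * (q C s) ≡ q C suc s + a * (q C s)
C-on-chord s q a q≤a a≤1+q with m≤n⇒m<n∨m≡n a≤1+q
... | inj₁ (s≤s a≤q) with ≤-antisym a≤q q≤a
...   | refl = refl
C-on-chord s q a q≤a a≤1+q | inj₂ refl = begin
    suc q C suc s + q * (q C s)
  ≡⟨ cong (_+ q * (q C s)) (sym (nCk+nC[k+1]≡[n+1]C[k+1] q s)) ⟩
    (q C s + q C suc s) + q * (q C s)
  ≡⟨ solve 3 (λ a b c → (a :+ b) :+ c := b :+ (a :+ c)) refl (q C s) (q C suc s) (q * (q C s)) ⟩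
    q C suc s + (q C s + q * (q C s))
  ∎
  where open ≡-Reasoning

∑-C-balanced≤ : ∀ m s q (a d : Fin m → ℕ) → (∀ i → q ≤ a i) → (∀ i → a i ≤ suc q) →
                ∑ m a ≤ ∑ m d → ∑ m (λ i → a i C suc s) ≤ ∑ m (λ i → d i C suc s)
∑-C-balanced≤ m s q a d q≤a a≤1+q ∑a≤∑d = +-cancelʳ-≤ K _ _ (begin
    ∑ m (λ i → a i C suc s) + K
  ≡⟨ sym (∑-distrib-+ m (λ i → a i C suc s) (λ _ → q * c)) ⟩
    ∑ m (λ i → a i C suc s + q * c)
  ≡⟨ ∑-cong m (λ i → C-on-chord s q (a i) (q≤a i) (a≤1+q i)) ⟩
    ∑ m (λ i → q C suc s + a i * c)
  ≡⟨ ∑-distrib-+ m (λ _ → q C suc s) (λ i → a i * c) ⟩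
    L + ∑ m (λ i → a i * c)
  ≡⟨ cong (L +_) (∑-distribʳ-* m a c) ⟩
    L + ∑ m a * c
  ≤⟨ +-monoʳ-≤ L (*-monoˡ-≤ c ∑a≤∑d) ⟩
    L + ∑ m d * c
  ≡⟨ cong (L +_) (sym (∑-distribʳ-* m d c)) ⟩
    L + ∑ m (λ i → d i * c)
  ≡⟨ sym (∑-distrib-+ m (λ _ → q C suc s) (λ i → d i * c)) ⟩
    ∑ m (λ i → q C suc s + d i * c)
  ≤⟨ ∑-mono-≤ m (λ i → C-above-chord s q (d i)) ⟩
    ∑ m (λ i → d i C suc s + q * c)
  ≡⟨ ∑-distrib-+ m (λ i → d i C suc s) (λ _ → q * c) ⟩
    ∑ m (λ i → d i C suc s) + K
  ∎)
  where
  open ≤-Reasoning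
  c : ℕ
  c = q C s
  K : ℕ
  K = ∑ m (λ _ → q * c)
  L : ℕ
  L = ∑ m (λ _ → q C suc s)

balanced⇒≤1+min : ∀ {m} (a : Fin m → ℕ) → (∀ i j → i <ᶠ j → ∣ a i - a j ∣ ≤ 1) →
                  ∀ k → (∀ i → a k ≤ a i) → ∀ i → a i ≤ suc (a k)
balanced⇒≤1+min a balanced k min i = begin
    a i                  ≡⟨ sym (m+[n∸m]≡n (min i)) ⟩
    a k + (a i ∸ a k)    ≤⟨ +-monoʳ-≤ (a k) (subst (_≤ 1) (m≤n⇒∣n-m∣≡n∸m (min i)) (∣a-a∣≤1 i k)) ⟩
    a k + 1              ≡⟨ +-comm (a k) 1 ⟩
    suc (a k)            ∎
  where
  open ≤-Reasoning
  ∣a-a∣≤1 : ∀ i j → ∣ a i - a j ∣ ≤ 1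
  ∣a-a∣≤1 i j with <ᶠ-cmp i j
  ... | tri< i<j _ _ = balanced i j i<j
  ... | tri≈ _ refl _ = ≤-trans (≤-reflexive (∣n-n∣≡0 (a i))) z≤n
  ... | tri> _ _ j<i = subst (_≤ 1) (∣-∣-comm (a j) (a i)) (balanced j i j<i)

zarankiewicz-balanced : ∀ m n s w (a : Fin (suc m) → ℕ) → ∑ (suc m) a ≡ w →
  (∀ i j → i <ᶠ j → ∣ a i - a j ∣ ≤ 1) → s * (n C suc s) < ∑ (suc m) (λ i → a i C suc s) →
  ∀ zmn → IsZarankiewicz (suc m) n (suc s) zmn → zmn < w
zarankiewicz-balanced m n s w a ∑a≡w balanced bound< zmn ((G , free , eG≡zmn) , _)
  with w ≤? zmn
... | no  w≰zmn = ≰⇒> w≰zmn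
... | yes w≤zmn = ⊥-elim (<⇒≱ bound< (begin
      ∑ (suc m) (λ i → a i C suc s)       ≤⟨ ∑-C-balanced≤ (suc m) s (a k) a (degree G) min
                                                (balanced⇒≤1+min a balanced k min) ∑a≤∑deg ⟩
      ∑ (suc m) (λ i → degree G i C suc s) ≤⟨ Kss-free⇒∑-degree-choose≤ (suc m) n s G free ⟩
      s * (n C suc s)                      ∎))
  where
  open ≤-Reasoning
  k : Fin (suc m)
  k = proj₁ (argmin m a)
  min : ∀ i → a k ≤ a i
  min = proj₂ (argmin m a)
  ∑a≤∑deg : ∑ (suc m) a ≤ edges G
  ∑a≤∑deg = subst₂ _≤_ (sym ∑a≡w) (sym eG≡zmn) w≤zmn

lemma4 :
  (∀ (m′ n s w : ℕ) → 1 ≤ m′ → 1 ≤ n → 1 ≤ s → 1 ≤ w →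
     ∀ (zprev z : ℕ) → IsZarankiewicz m′ n s zprev →
     zprev < z → z ≤ w ∸ (w / suc m′) →
     ∀ (zmn : ℕ) → IsZarankiewicz (suc m′) n s zmn → zmn < w)
  ×
  (∀ (m n s w : ℕ) → 1 ≤ m → 1 ≤ n → 1 ≤ s → 1 ≤ w →
     ∀ (a : Fin m → ℕ) → ∑ m a ≡ w →
     (∀ (i j : Fin m) → i <ᶠ j → ∣ a i - a j ∣ ≤ 1) →
     (s ∸ 1) * (n C s) < ∑ m (λ i → a i C s) →
     ∀ (zmn : ℕ) → IsZarankiewicz m n s zmn → zmn < w)
lemma4 =
    (λ m′ n s w _ _ _ _ zprev z zprev-opt zprev<z z≤ →
       zarankiewicz-step m′ n s w zprev zprev-opt (<-≤-trans zprev<z z≤))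
  , λ { zero    _ _       _ ()
      ; (suc m) _ zero    _ _ _ ()
      ; (suc m) n (suc s) w _ _ _ _ → zarankiewicz-balanced m n s w }
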